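{- Let $\mathcal{A}$ be an algebra. 1) If a stable preorder $\preceq$ on $\mathcal{A}$ is sp-residually finite then its associated congruence is c-residually finite. 2) A congruence on $\mathcal{A}$ is c-residually finite if and only if, viewed as a preorder, it is sp-residually finite. 3) If $\mathcal{A}$ is sp-residually finite then it is also c-residually finite.
   Context: For an algebra $\mathcal{A}=\langle A;\Xi\rangle$: a relation is stable if compatible with every operation ($x_i\rho y_i$ for all $i$ implies $\xi(\vec x)\rho\xi(\vec y)$); a stable preorder is a reflexive transitive stable relation; its associated congruence is $x\sim y\iff x\preceq y\wedge y\preceq x$; a congruence is a stable equivalence relation. A congruence is c-residually finite if it is the intersection of a family of congruences each with finitely many classes. A stable preorder is sp-residually finite if it is the intersection of a family of stable preorders each of whose associated congruences has finitely many classes. $\mathcal{A}$ is c-residually finite (resp. sp-residually finite) if all its congruences are c-residually finite (resp. all its stable preorders are sp-residually finite). -}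

module Defs where

open import Level using (0ℓ)
open import Data.Nat using (ℕ)
open import Data.Vec using (Vec)
open import Data.Vec.Relation.Binary.Pointwise.Inductive using (Pointwise)
open import Data.List using (List)
open import Data.List.Membership.Propositional using (_∈_)
open import Data.Product using (Σ; _×_; ∃; ∃-syntax)
open import Relation.Binary using (Rel; Reflexive; Transitive; IsEquivalence)

record Algebra : Set₁ where
  field
    Carrier : Set
    Op      : Set
    arity   : Op → ℕ
    ⟦_⟧     : (ξ : Op) → Vec Carrier (arity ξ) → Carrier

module _ (𝒜 : Algebra) where
  open Algebra 𝒜

  Stable : Rel Carrier 0ℓ → Set
  Stable ρ = ∀ (ξ : Op) (xs ys : Vec Carrier (arity ξ)) →
             Pointwise ρ xs ys → ρ (⟦ ξ ⟧ xs) (⟦ ξ ⟧ ys)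

  record IsStablePreorder (ρ : Rel Carrier 0ℓ) : Set where
    field
      refl   : Reflexive ρ
      trans  : Transitive ρ
      stable : Stable ρ

  record IsCongruence (ρ : Rel Carrier 0ℓ) : Set where
    field
      isEquivalence : IsEquivalence ρ
      stable        : Stable ρ

Assoc : {A : Set} → Rel A 0ℓ → Rel A 0ℓ
Assoc ρ x y = ρ x y × ρ y x

FinitelyManyClasses : {A : Set} → Rel A 0ℓ → Set
FinitelyManyClasses {A} ρ = Σ (List A) λ L → ∀ x → ∃[ y ] (y ∈ L × ρ x y)

IsIntersection : {A : Set} {I : Set} → Rel A 0ℓ → (I → Rel A 0ℓ) → Set
IsIntersection {A} {I} ρ F = ∀ (x y : A) → (ρ x y → ∀ i → F i x y) × ((∀ i → F i x y) → ρ x y)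

module _ (𝒜 : Algebra) where
  open Algebra 𝒜

  CResiduallyFinite : Rel Carrier 0ℓ → Set₁
  CResiduallyFinite θ =
    Σ Set λ I → Σ (I → Rel Carrier 0ℓ) λ F →
      (∀ i → IsCongruence 𝒜 (F i) × FinitelyManyClasses (F i)) × IsIntersection θ F

  SPResiduallyFinite : Rel Carrier 0ℓ → Set₁
  SPResiduallyFinite ρ =
    Σ Set λ I → Σ (I → Rel Carrier 0ℓ) λ F →
      (∀ i → IsStablePreorder 𝒜 (F i) × FinitelyManyClasses (Assoc (F i))) × IsIntersection ρ F

  AlgCResiduallyFinite : Set₁
  AlgCResiduallyFinite = ∀ θ → IsCongruence 𝒜 θ → CResiduallyFinite θ

  AlgSPResiduallyFinite : Set₁
  AlgSPResiduallyFinite = ∀ ρ → IsStablePreorder 𝒜 ρ → SPResiduallyFinite ρ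

-- Taking associated congruences commutes with intersections, and turns stable
-- preorders into congruences with the same (finitely many) classes; hence an
-- sp-residual representation of ⪯ yields a c-residual one of its associated
-- congruence. A congruence θ is a
-- stable preorder with Assoc θ = θ, which gives both directions of 2) and then 3).
module Submission where

open import Defs
open import Data.Product using (_×_; _,_; proj₁; proj₂)
open import Function.Bundles using (_⇔_; mk⇔)
open import Level using (0ℓ)
open import Relation.Binary using (Rel; _⇒_; Symmetric; IsEquivalence)
import Data.Vec.Relation.Binary.Pointwise.Inductive as Pointwise

module _ {A : Set} where

  Assoc-sym : {ρ : Rel A 0ℓ} → Symmetric ρ → ρ ⇒ Assoc ρ
  Assoc-sym sym r = r , sym r

  FinitelyManyClasses-mono : {ρ σ : Rel A 0ℓ} → ρ ⇒ σ → FinitelyManyClasses ρ → FinitelyManyClasses σ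
  FinitelyManyClasses-mono ρ⇒σ (L , cover) = L , λ x →
    let y , y∈L , xρy = cover x in y , y∈L , ρ⇒σ xρy

  IsIntersection-resp : {I : Set} {ρ σ : Rel A 0ℓ} {F : I → Rel A 0ℓ} →
    ρ ⇒ σ → σ ⇒ ρ → IsIntersection ρ F → IsIntersection σ F
  IsIntersection-resp ρ⇒σ σ⇒ρ ρ≡⋂F x y =
    (λ r → proj₁ (ρ≡⋂F x y) (σ⇒ρ r)) , (λ rs → ρ⇒σ (proj₂ (ρ≡⋂F x y) rs))

  Assoc-intersection : {I : Set} {ρ : Rel A 0ℓ} {F : I → Rel A 0ℓ} →
    IsIntersection ρ F → IsIntersection (Assoc ρ) (λ i → Assoc (F i))
  Assoc-intersection ρ≡⋂F x y =
    (λ (xρy , yρx) i → proj₁ (ρ≡⋂F x y) xρy i , proj₁ (ρ≡⋂F y x) yρx i) ,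
    (λ rs → proj₂ (ρ≡⋂F x y) (λ i → proj₁ (rs i)) , proj₂ (ρ≡⋂F y x) (λ i → proj₂ (rs i)))

module _ (𝒜 : Algebra) where
  open Algebra 𝒜

  Assoc-isCongruence : {ρ : Rel Carrier 0ℓ} → IsStablePreorder 𝒜 ρ → IsCongruence 𝒜 (Assoc ρ)
  Assoc-isCongruence sp = record
    { isEquivalence = record
      { refl  = P.refl , P.refl
      ; sym   = λ (xρy , yρx) → yρx , xρy
      ; trans = λ (xρy , yρx) (yρz , zρy) → P.trans xρy yρz , P.trans zρy yρx
      }
    ; stable = λ ξ xs ys xs≈ys →
        P.stable ξ xs ys (Pointwise.map proj₁ xs≈ys) ,
        P.stable ξ ys xs (Pointwise.sym proj₂ xs≈ys)
    }
    where module P = IsStablePreorder sp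

  IsCongruence-sym : {θ : Rel Carrier 0ℓ} → IsCongruence 𝒜 θ → Symmetric θ
  IsCongruence-sym c = IsEquivalence.sym (IsCongruence.isEquivalence c)

  isCongruence⇒isStablePreorder : {θ : Rel Carrier 0ℓ} → IsCongruence 𝒜 θ → IsStablePreorder 𝒜 θ
  isCongruence⇒isStablePreorder c = record { refl = E.refl ; trans = E.trans ; stable = C.stable }
    where
      module C = IsCongruence c
      module E = IsEquivalence C.isEquivalence

  CResiduallyFinite-resp : {θ θ′ : Rel Carrier 0ℓ} →
    θ ⇒ θ′ → θ′ ⇒ θ → CResiduallyFinite 𝒜 θ → CResiduallyFinite 𝒜 θ′
  CResiduallyFinite-resp θ⇒θ′ θ′⇒θ (I , F , finite , θ≡⋂F) =
    I , F , finite , IsIntersection-resp θ⇒θ′ θ′⇒θ θ≡⋂F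

  SPResiduallyFinite⇒CResiduallyFinite-Assoc : {ρ : Rel Carrier 0ℓ} →
    SPResiduallyFinite 𝒜 ρ → CResiduallyFinite 𝒜 (Assoc ρ)
  SPResiduallyFinite⇒CResiduallyFinite-Assoc (I , F , finite , ρ≡⋂F) =
    I , (λ i → Assoc (F i)) ,
    (λ i → Assoc-isCongruence (proj₁ (finite i)) , proj₂ (finite i)) ,
    Assoc-intersection ρ≡⋂F

  CResiduallyFinite⇒SPResiduallyFinite : {θ : Rel Carrier 0ℓ} →
    CResiduallyFinite 𝒜 θ → SPResiduallyFinite 𝒜 θ
  CResiduallyFinite⇒SPResiduallyFinite (I , F , finite , θ≡⋂F) =
    I , F , (λ i → spFinite (finite i)) , θ≡⋂F
    where
      spFinite : {φ : Rel Carrier 0ℓ} → IsCongruence 𝒜 φ × FinitelyManyClasses φ →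
                 IsStablePreorder 𝒜 φ × FinitelyManyClasses (Assoc φ)
      spFinite {φ} (c , fin) =
        isCongruence⇒isStablePreorder c ,
        FinitelyManyClasses-mono (Assoc-sym {ρ = φ} (IsCongruence-sym c)) fin

  SPResiduallyFinite⇒CResiduallyFinite : {θ : Rel Carrier 0ℓ} → IsCongruence 𝒜 θ →
    SPResiduallyFinite 𝒜 θ → CResiduallyFinite 𝒜 θ
  SPResiduallyFinite⇒CResiduallyFinite {θ} c spRF =
    CResiduallyFinite-resp proj₁ (Assoc-sym {ρ = θ} (IsCongruence-sym c))
      (SPResiduallyFinite⇒CResiduallyFinite-Assoc spRF)

lemma4p8 : (𝒜 : Algebra) →
    ((ρ : Rel (Algebra.Carrier 𝒜) 0ℓ) → IsStablePreorder 𝒜 ρ → SPResiduallyFinite 𝒜 ρ → CResiduallyFinite 𝒜 (Assoc ρ))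
    × ((θ : Rel (Algebra.Carrier 𝒜) 0ℓ) → IsCongruence 𝒜 θ → (CResiduallyFinite 𝒜 θ ⇔ SPResiduallyFinite 𝒜 θ))
    × (AlgSPResiduallyFinite 𝒜 → AlgCResiduallyFinite 𝒜)
lemma4p8 𝒜 =
  (λ _ _ → SPResiduallyFinite⇒CResiduallyFinite-Assoc 𝒜) ,
  (λ _ c → mk⇔ (CResiduallyFinite⇒SPResiduallyFinite 𝒜) (SPResiduallyFinite⇒CResiduallyFinite 𝒜 c)) ,
  (λ spRF θ c → SPResiduallyFinite⇒CResiduallyFinite 𝒜 c (spRF θ (isCongruence⇒isStablePreorder 𝒜 c)))
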